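{- For every integer $k>1$, \[\sum_{n=1}^{\infty}\frac{(-1)^{n+1}}{T_k(n)} = \frac{k}{k-1}\left(2\sum_{n=1}^{\infty}\frac{(-1)^{n+1}}{T_{k-1}(n)} - 1 \right).\]
   Context: The generalized (higher-order) triangular numbers are defined by $T_0(n)=1$ for all positive integers $n$, and for each positive integer $k$, $T_k(n)=\sum_{i=1}^{n} T_{k-1}(i)$. Thus $T_1(n)=n$, $T_2(n)=n(n+1)/2$, and in general $T_k(n)=\frac{n(n+1)\cdots(n+k-1)}{k!}$. -}

module Defs where

open import Data.Nat as ℕ using (ℕ; zero; suc; _∸_; NonZero; >-nonZero)
import Data.Nat.Properties as ℕP
open import Data.Integer as ℤ using (ℤ; +_)
open import Data.Rational using (ℚ; _/_; _+_; _-_; _*_; _<_; ∣_∣; 0ℚ; 1ℚ)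
open import Data.Product using (Σ; ∃; _×_)

-- Generalized triangular numbers: T 0 n = 1, T (k+1) n = Σ_{i=1}^{n} T k i.
T : ℕ → ℕ → ℕ
T zero    n       = 1
T (suc k) zero    = 0
T (suc k) (suc n) = T (suc k) n ℕ.+ T k (suc n)

T-pos : ∀ k n → 0 ℕ.< T k (suc n)
T-pos zero    n       = ℕ.s≤s ℕ.z≤n
T-pos (suc k) n = ℕP.<-≤-trans (T-pos k n) (ℕP.m≤n+m (T k (suc n)) (T (suc k) n))

sgn : ℕ → ℤ
sgn zero          = + 1            -- unused (n ≥ 1 only)
sgn (suc zero)    = + 1
sgn (suc (suc n)) = ℤ.- sgn (suc n)

-- the n-th term (-1)^(n+1) / T_k(n), for n ≥ 1 (index n = suc i)
term : ℕ → ℕ → ℚ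
term k i = _/_ (sgn (suc i)) (T k (suc i)) {{>-nonZero (T-pos k i)}}

S : ℕ → ℕ → ℚ
S k zero    = 0ℚ
S k (suc N) = S k N + term k N

-- Cauchy sequences of rationals (i.e. convergent in ℝ)
IsCauchy : (ℕ → ℚ) → Set
IsCauchy a = ∀ (ε : ℚ) → 0ℚ < ε →
  ∃ λ N → ∀ m n → N ℕ.≤ m → N ℕ.≤ n → ∣ a m - a n ∣ < ε

-- two rational sequences have the same limit (equality of Cauchy reals)
SameLimit : (ℕ → ℚ) → (ℕ → ℚ) → Set
SameLimit a b = ∀ (ε : ℚ) → 0ℚ < ε →
  ∃ λ N → ∀ m → N ℕ.≤ m → ∣ a m - b m ∣ < ε

ratio : (k : ℕ) → 1 ℕ.< k → ℚ
ratio k h = _/_ (+ k) (k ∸ 1) {{>-nonZero (ℕP.m<n⇒0<n∸m h)}}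

two : ℚ
two = 1ℚ + 1ℚ

-- The absorption identity k T_k(n) = n T_{k-1}(n+1) gives
-- 1/T_k(n) = k/(k-1) (1/T_{k-1}(n) - 1/T_{k-1}(n+1)). Summed with alternating signs this
-- telescopes to S_k(N) = k/(k-1) (2 S_{k-1}(N) - 1 + (-1)^N / T_{k-1}(N+1)), and the last
-- term is at most 2/(N+1). Both series converge by the alternating series test, since
-- 1/T_{k-1}(n) decreases and is at most 1/n.
module Submission where

open import Defs
open import Data.Nat as ℕ using (ℕ; zero; suc; _∸_)
import Data.Nat.Properties as ℕP
open import Data.Integer as ℤ using (ℤ; +_)
import Data.Integer.Properties as ℤP
open import Data.Rational
open import Data.Rational.Properties
import Data.Rational.Unnormalised as ℚᵘ
import Data.Rational.Unnormalised.Properties as ℚᵘP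
open import Data.Rational.Solver using (module +-*-Solver)
open import Data.Product using (_×_; _,_; ∃; proj₁; proj₂)
open import Data.Sum using (inj₁; inj₂)
open import Relation.Binary.PropositionalEquality

open +-*-Solver

T-1ˡ : ∀ n → T 1 n ≡ n
T-1ˡ zero    = refl
T-1ˡ (suc n) = trans (ℕP.+-comm (T 1 n) 1) (cong suc (T-1ˡ n))

T-1ʳ : ∀ k → T k 1 ≡ 1
T-1ʳ zero    = refl
T-1ʳ (suc k) = T-1ʳ k

T-nonZero : ∀ k n → ℕ.NonZero (T k (suc n))
T-nonZero k n = ℕ.>-nonZero (T-pos k n)

n≤T : ∀ k n → n ℕ.≤ T (suc k) n
n≤T k zero    = ℕ.z≤n
n≤T k (suc n) = subst (ℕ._≤ T (suc k) n ℕ.+ T k (suc n)) (ℕP.+-comm n 1)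
                      (ℕP.+-mono-≤ (n≤T k n) (T-pos k n))

T-absorption : ∀ k n → suc k ℕ.* T (suc k) n ≡ n ℕ.* T k (suc n)
T-absorption zero    n       = trans (ℕP.+-identityʳ (T 1 n)) (trans (T-1ˡ n) (sym (ℕP.*-identityʳ n)))
T-absorption (suc k) zero    = ℕP.*-zeroʳ (suc (suc k))
T-absorption (suc k) (suc n) = begin
    suc (suc k) ℕ.* (T (suc (suc k)) n ℕ.+ A)
  ≡⟨ ℕP.*-distribˡ-+ (suc (suc k)) (T (suc (suc k)) n) A ⟩
    suc (suc k) ℕ.* T (suc (suc k)) n ℕ.+ (A ℕ.+ suc k ℕ.* A)
  ≡⟨ cong₂ (λ x y → x ℕ.+ (A ℕ.+ y)) (T-absorption (suc k) n) (T-absorption k (suc n)) ⟩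
    n ℕ.* A ℕ.+ (A ℕ.+ suc n ℕ.* B)
  ≡⟨ rearrange n A B ⟩
    suc n ℕ.* (A ℕ.+ B)
  ∎
  where
  open ≡-Reasoning
  open import Data.Nat.Tactic.RingSolver using (solve-∀)
  A = T (suc k) (suc n)
  B = T k (suc (suc n))
  rearrange : ∀ n a b → n ℕ.* a ℕ.+ (a ℕ.+ suc n ℕ.* b) ≡ suc n ℕ.* (a ℕ.+ b)
  rearrange = solve-∀

T-cross : ∀ k i → suc (suc k) ℕ.* T (suc (suc k)) (suc i) ℕ.* T k (suc (suc i))
                ≡ suc k ℕ.* (T (suc k) (suc i) ℕ.* T (suc k) (suc (suc i)))
T-cross k i = begin
    suc (suc k) ℕ.* T (suc (suc k)) (suc i) ℕ.* C
  ≡⟨ cong (ℕ._* C) (T-absorption (suc k) (suc i)) ⟩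
    suc i ℕ.* B ℕ.* C
  ≡⟨ trans (cong (ℕ._* C) (ℕP.*-comm (suc i) B)) (ℕP.*-assoc B (suc i) C) ⟩
    B ℕ.* (suc i ℕ.* C)
  ≡⟨ cong (B ℕ.*_) (sym (T-absorption k (suc i))) ⟩
    B ℕ.* (suc k ℕ.* A)
  ≡⟨ trans (ℕP.*-comm B (suc k ℕ.* A)) (ℕP.*-assoc (suc k) A B) ⟩
    suc k ℕ.* (A ℕ.* B)
  ∎
  where
  open ≡-Reasoning
  A = T (suc k) (suc i)
  B = T (suc k) (suc (suc i))
  C = T k (suc (suc i))

toℚᵘ-/ : ∀ p n .{{_ : ℕ.NonZero n}} → toℚᵘ (p / n) ℚᵘ.≃ (p ℚᵘ./ n)
toℚᵘ-/ p (suc n) = toℚᵘ-fromℚᵘ (ℚᵘ.mkℚᵘ p n)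

*≡*⇒/≡/ : ∀ p q a b .{{_ : ℕ.NonZero a}} .{{_ : ℕ.NonZero b}} →
          p ℤ.* + b ≡ q ℤ.* + a → p / a ≡ q / b
*≡*⇒/≡/ p q a@(suc _) b@(suc _) eq = toℚᵘ-injective
  (ℚᵘP.≃-trans (toℚᵘ-/ p a) (ℚᵘP.≃-trans (ℚᵘ.*≡* eq) (ℚᵘP.≃-sym (toℚᵘ-/ q b))))

*≤*⇒/≤/ : ∀ p q a b .{{_ : ℕ.NonZero a}} .{{_ : ℕ.NonZero b}} →
          p ℕ.* b ℕ.≤ q ℕ.* a → + p / a ≤ + q / b
*≤*⇒/≤/ p q a@(suc _) b@(suc _) le = toℚᵘ-cancel-≤
  (ℚᵘP.≤-respˡ-≃ (ℚᵘP.≃-sym (toℚᵘ-/ (+ p) a)) (ℚᵘP.≤-respʳ-≃ (ℚᵘP.≃-sym (toℚᵘ-/ (+ q) b))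
    (ℚᵘ.*≤* (subst₂ ℤ._≤_ (ℤP.pos-* p b) (ℤP.pos-* q a) (ℤ.+≤+ le)))))

neg-/ : ∀ p n .{{_ : ℕ.NonZero n}} → - (p / n) ≡ (ℤ.- p) / n
neg-/ p n@(suc _) = toℚᵘ-injective (ℚᵘP.≃-trans (toℚᵘ-homo‿- (p / n))
  (ℚᵘP.≃-trans (ℚᵘP.-‿cong (toℚᵘ-/ p n)) (ℚᵘP.≃-sym (toℚᵘ-/ (ℤ.- p) n))))

/+/ : ∀ p q a b .{{_ : ℕ.NonZero a}} .{{_ : ℕ.NonZero b}} →
      p / a + q / b ≡ _/_ (p ℤ.* + b ℤ.+ q ℤ.* + a) (a ℕ.* b) {{ℕP.m*n≢0 a b}}
/+/ p q a@(suc _) b@(suc _) = toℚᵘ-injective (ℚᵘP.≃-trans (toℚᵘ-homo-+ (p / a) (q / b))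
  (ℚᵘP.≃-trans (ℚᵘP.+-cong (toℚᵘ-/ p a) (toℚᵘ-/ q b)) (ℚᵘP.≃-sym (toℚᵘ-/ _ (a ℕ.* b)))))

/*/ : ∀ p q a b .{{_ : ℕ.NonZero a}} .{{_ : ℕ.NonZero b}} →
      p / a * (q / b) ≡ _/_ (p ℤ.* q) (a ℕ.* b) {{ℕP.m*n≢0 a b}}
/*/ p q a@(suc _) b@(suc _) = toℚᵘ-injective (ℚᵘP.≃-trans (toℚᵘ-homo-* (p / a) (q / b))
  (ℚᵘP.≃-trans (ℚᵘP.*-cong (toℚᵘ-/ p a) (toℚᵘ-/ q b)) (ℚᵘP.≃-sym (toℚᵘ-/ _ (a ℕ.* b)))))

/-/ : ∀ p q a b .{{_ : ℕ.NonZero a}} .{{_ : ℕ.NonZero b}} →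
      p / a - q / b ≡ _/_ (p ℤ.* + b ℤ.- q ℤ.* + a) (a ℕ.* b) {{ℕP.m*n≢0 a b}}
/-/ p q a b = begin
    p / a + - (q / b)
  ≡⟨ cong (λ x → p / a + x) (neg-/ q b) ⟩
    p / a + (ℤ.- q) / b
  ≡⟨ /+/ p (ℤ.- q) a b ⟩
    _/_ (p ℤ.* + b ℤ.+ (ℤ.- q) ℤ.* + a) (a ℕ.* b) {{ℕP.m*n≢0 a b}}
  ≡⟨ cong (λ x → _/_ (p ℤ.* + b ℤ.+ x) (a ℕ.* b) {{ℕP.m*n≢0 a b}}) (sym (ℤP.neg-distribˡ-* q (+ a))) ⟩
    _/_ (p ℤ.* + b ℤ.- q ℤ.* + a) (a ℕ.* b) {{ℕP.m*n≢0 a b}}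
  ∎
  where open ≡-Reasoning

p≤q⇒0≤q-p : ∀ {p q} → p ≤ q → 0ℚ ≤ q - p
p≤q⇒0≤q-p {p} {q} p≤q = subst (_≤ q - p) (+-inverseʳ p) (+-monoˡ-≤ (- p) p≤q)

0≤p⇒q-p≤q : ∀ {p} q → 0ℚ ≤ p → q - p ≤ q
0≤p⇒q-p≤q {p} q 0≤p = subst (q - p ≤_) (+-identityʳ q) (+-monoʳ-≤ q (neg-antimono-≤ 0≤p))

sign : ℕ → ℚ
sign zero    = 1ℚ
sign (suc i) = - sign i

∣sign*p∣≡∣p∣ : ∀ i p → ∣ sign i * p ∣ ≡ ∣ p ∣
∣sign*p∣≡∣p∣ zero    p = cong ∣_∣ (*-identityˡ p)
∣sign*p∣≡∣p∣ (suc i) p = begin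
    ∣ - sign i * p ∣      ≡⟨ cong ∣_∣ (sym (neg-distribˡ-* (sign i) p)) ⟩
    ∣ - (sign i * p) ∣    ≡⟨ ∣-p∣≡∣p∣ (sign i * p) ⟩
    ∣ sign i * p ∣        ≡⟨ ∣sign*p∣≡∣p∣ i p ⟩
    ∣ p ∣                 ∎
  where open ≡-Reasoning

alternatingSum : (ℕ → ℚ) → ℕ → ℚ
alternatingSum a zero    = 0ℚ
alternatingSum a (suc N) = alternatingSum a N + sign N * a N

alternatingSum-cong : ∀ {a b} → (∀ i → a i ≡ b i) → ∀ N → alternatingSum a N ≡ alternatingSum b N
alternatingSum-cong a≡b zero    = refl
alternatingSum-cong a≡b (suc N) = cong₂ (λ x y → x + sign N * y) (alternatingSum-cong a≡b N) (a≡b N)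

alternatingSum-*ˡ : ∀ c a N → alternatingSum (λ i → c * a i) N ≡ c * alternatingSum a N
alternatingSum-*ˡ c a zero    = sym (*-zeroʳ c)
alternatingSum-*ˡ c a (suc N) = begin
    alternatingSum (λ i → c * a i) N + sign N * (c * a N)
  ≡⟨ cong₂ _+_ (alternatingSum-*ˡ c a N) (solve 3 (λ s c x → s :* (c :* x) := c :* (s :* x)) refl (sign N) c (a N)) ⟩
    c * alternatingSum a N + c * (sign N * a N)
  ≡⟨ sym (*-distribˡ-+ c (alternatingSum a N) (sign N * a N)) ⟩
    c * (alternatingSum a N + sign N * a N)
  ∎
  where open ≡-Reasoning

alternatingSum-telescope : ∀ a N →
  alternatingSum (λ i → a i - a (suc i)) N ≡ two * alternatingSum a N - a 0 + sign N * a N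
alternatingSum-telescope a zero    =
  solve 1 (λ a₀ → con 0ℚ := (con 1ℚ :+ con 1ℚ) :* con 0ℚ :- a₀ :+ con 1ℚ :* a₀) refl (a 0)
alternatingSum-telescope a (suc N) = begin
    alternatingSum (λ i → a i - a (suc i)) N + sign N * (a N - a (suc N))
  ≡⟨ cong (_+ sign N * (a N - a (suc N))) (alternatingSum-telescope a N) ⟩
    two * A - a 0 + sign N * a N + sign N * (a N - a (suc N))
  ≡⟨ solve 5 (λ A a₀ s x y → (con 1ℚ :+ con 1ℚ) :* A :- a₀ :+ s :* x :+ s :* (x :- y)
                          := (con 1ℚ :+ con 1ℚ) :* (A :+ s :* x) :- a₀ :+ (:- s) :* y)
             refl A (a 0) (sign N) (a N) (a (suc N)) ⟩
    two * (A + sign N * a N) - a 0 + sign (suc N) * a (suc N)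
  ∎
  where
  open ≡-Reasoning
  A = alternatingSum a N

alternatingTail : (ℕ → ℚ) → ℕ → ℕ → ℚ
alternatingTail a m zero    = 0ℚ
alternatingTail a m (suc d) = a m - alternatingTail a (suc m) d

alternatingSum-+ : ∀ a m d →
  alternatingSum a (m ℕ.+ d) ≡ alternatingSum a m + sign m * alternatingTail a m d
alternatingSum-+ a m zero = begin
    alternatingSum a (m ℕ.+ 0)   ≡⟨ cong (alternatingSum a) (ℕP.+-identityʳ m) ⟩
    alternatingSum a m           ≡⟨ sym (+-identityʳ _) ⟩
    alternatingSum a m + 0ℚ      ≡⟨ cong (λ x → alternatingSum a m + x) (sym (*-zeroʳ (sign m))) ⟩
    alternatingSum a m + sign m * 0ℚ ∎
  where open ≡-Reasoning
alternatingSum-+ a m (suc d) = begin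
    alternatingSum a (m ℕ.+ suc d)
  ≡⟨ cong (alternatingSum a) (ℕP.+-suc m d) ⟩
    alternatingSum a (suc m ℕ.+ d)
  ≡⟨ alternatingSum-+ a (suc m) d ⟩
    alternatingSum a m + sign m * a m + (- sign m) * alternatingTail a (suc m) d
  ≡⟨ solve 4 (λ A s x t → A :+ s :* x :+ (:- s) :* t := A :+ s :* (x :- t))
             refl (alternatingSum a m) (sign m) (a m) (alternatingTail a (suc m) d) ⟩
    alternatingSum a m + sign m * (a m - alternatingTail a (suc m) d)
  ∎
  where open ≡-Reasoning

module _ (a : ℕ → ℚ) (antitone : ∀ i → a (suc i) ≤ a i) (nonNeg : ∀ i → 0ℚ ≤ a i) where

  alternatingTail-bounds : ∀ m d → 0ℚ ≤ alternatingTail a m d × alternatingTail a m d ≤ a m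
  alternatingTail-bounds m zero    = ≤-refl , nonNeg m
  alternatingTail-bounds m (suc d) with alternatingTail-bounds (suc m) d
  ... | 0≤t , t≤a = p≤q⇒0≤q-p (≤-trans t≤a (antitone m)) , 0≤p⇒q-p≤q (a m) 0≤t

  alternatingSum-increment-≤ : ∀ m d → ∣ alternatingSum a (m ℕ.+ d) - alternatingSum a m ∣ ≤ a m
  alternatingSum-increment-≤ m d = subst (_≤ a m) (sym increment≡tail) (proj₂ (alternatingTail-bounds m d))
    where
    open ≡-Reasoning
    t = alternatingTail a m d
    increment≡tail : ∣ alternatingSum a (m ℕ.+ d) - alternatingSum a m ∣ ≡ t
    increment≡tail = begin
        ∣ alternatingSum a (m ℕ.+ d) - alternatingSum a m ∣
      ≡⟨ cong (λ x → ∣ x - alternatingSum a m ∣) (alternatingSum-+ a m d) ⟩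
        ∣ alternatingSum a m + sign m * t - alternatingSum a m ∣
      ≡⟨ cong ∣_∣ (solve 2 (λ x y → x :+ y :- x := y) refl (alternatingSum a m) (sign m * t)) ⟩
        ∣ sign m * t ∣
      ≡⟨ ∣sign*p∣≡∣p∣ m t ⟩
        ∣ t ∣
      ≡⟨ 0≤p⇒∣p∣≡p (proj₁ (alternatingTail-bounds m d)) ⟩
        t
      ∎

∣p-q∣≡∣q-p∣ : ∀ p q → ∣ p - q ∣ ≡ ∣ q - p ∣
∣p-q∣≡∣q-p∣ p q = trans (cong ∣_∣ (solve 2 (λ p q → p :- q := :- (q :- p)) refl p q)) (∣-p∣≡∣p∣ (q - p))

/suc-eventually-< : ∀ c ε → 0ℚ < ε → ∃ λ N → ∀ m → N ℕ.≤ m → + c / suc m < ε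
-- ε = (n+1)/(d+1) ≥ 1/(d+1), so N = c(d+1) suffices.
/suc-eventually-< c ε@(mkℚ (+ suc n) d _) _ = c ℕ.* suc d , λ m N≤m →
  toℚᵘ-cancel-< (ℚᵘP.<-respˡ-≃ (ℚᵘP.≃-sym (toℚᵘ-/ (+ c) (suc m))) (ℚᵘ.*<*
    (subst₂ ℤ._<_ (ℤP.pos-* c (suc d)) (ℤP.pos-* (suc n) (suc m))
      (ℤ.+<+ (ℕP.<-≤-trans (ℕ.s≤s N≤m) (ℕP.m≤n*m (suc m) (suc n)))))))
/suc-eventually-< c (mkℚ (+ zero) d _) (*<* (ℤ.+<+ ()))
/suc-eventually-< c (mkℚ ℤ.-[1+ n ] d _) (*<* ())

isCauchy-if-increments-≤ : ∀ (A : ℕ → ℚ) c →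
  (∀ m d → ∣ A (m ℕ.+ d) - A m ∣ ≤ + c / suc m) → IsCauchy A
isCauchy-if-increments-≤ A c increment-≤ ε ε>0 with /suc-eventually-< c ε ε>0
... | N , bound = N , close
  where
  increment-< : ∀ m d → N ℕ.≤ m → ∣ A (m ℕ.+ d) - A m ∣ < ε
  increment-< m d N≤m = ≤-<-trans (increment-≤ m d) (bound m N≤m)
  close : ∀ m n → N ℕ.≤ m → N ℕ.≤ n → ∣ A m - A n ∣ < ε
  close m n N≤m N≤n with ℕP.≤-total m n
  ... | inj₁ m≤n = subst (λ k → ∣ A m - A k ∣ < ε) (ℕP.m+[n∸m]≡n m≤n)
                     (subst (_< ε) (∣p-q∣≡∣q-p∣ (A (m ℕ.+ (n ∸ m))) (A m)) (increment-< m (n ∸ m) N≤m))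
  ... | inj₂ n≤m = subst (λ k → ∣ A k - A n ∣ < ε) (ℕP.m+[n∸m]≡n n≤m) (increment-< n (m ∸ n) N≤n)

sameLimit-if-≤ : ∀ (A B : ℕ → ℚ) c → (∀ m → ∣ A m - B m ∣ ≤ + c / suc m) → SameLimit A B
sameLimit-if-≤ A B c distance-≤ ε ε>0 with /suc-eventually-< c ε ε>0
... | N , bound = N , λ m N≤m → ≤-<-trans (distance-≤ m) (bound m N≤m)

sgn/n≡sign*1/n : ∀ i n .{{_ : ℕ.NonZero n}} → sgn (suc i) / n ≡ sign i * (+ 1 / n)
sgn/n≡sign*1/n zero    n = sym (*-identityˡ _)
sgn/n≡sign*1/n (suc i) n = begin
    (ℤ.- sgn (suc i)) / n      ≡⟨ sym (neg-/ (sgn (suc i)) n) ⟩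
    - (sgn (suc i) / n)        ≡⟨ cong -_ (sgn/n≡sign*1/n i n) ⟩
    - (sign i * (+ 1 / n))     ≡⟨ neg-distribˡ-* (sign i) _ ⟩
    - sign i * (+ 1 / n)       ∎
  where open ≡-Reasoning

1/T : ℕ → ℕ → ℚ
1/T k i = _/_ (+ 1) (T k (suc i)) {{T-nonZero k i}}

S≡alternatingSum : ∀ k N → S k N ≡ alternatingSum (1/T k) N
S≡alternatingSum k zero    = refl
S≡alternatingSum k (suc N) =
  cong₂ _+_ (S≡alternatingSum k N) (sgn/n≡sign*1/n N (T k (suc N)) {{T-nonZero k N}})

1/T-0 : ∀ k → 1/T k 0 ≡ 1ℚ
1/T-0 k = /-cong {p₁ = + 1} {q₁ = T k 1} {{T-nonZero k 0}} refl (T-1ʳ k)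

1/T-telescope : ∀ k (h : 1 ℕ.< k) i → 1/T k i ≡ ratio k h * (1/T (k ∸ 1) i - 1/T (k ∸ 1) (suc i))
1/T-telescope (suc zero)    (ℕ.s≤s ())
1/T-telescope (suc (suc j)) h i = sym (begin
    + k / suc j * (+ 1 / A - + 1 / B)
  ≡⟨ cong (λ x → + k / suc j * x) (/-/ (+ 1) (+ 1) A B) ⟩
    + k / suc j * ((+ 1 ℤ.* + B ℤ.- + 1 ℤ.* + A) / (A ℕ.* B))
  ≡⟨ /*/ (+ k) (+ 1 ℤ.* + B ℤ.- + 1 ℤ.* + A) (suc j) (A ℕ.* B) ⟩
    (+ k ℤ.* (+ 1 ℤ.* + B ℤ.- + 1 ℤ.* + A)) / (suc j ℕ.* (A ℕ.* B))
  ≡⟨ *≡*⇒/≡/ (+ k ℤ.* (+ 1 ℤ.* + B ℤ.- + 1 ℤ.* + A)) (+ 1) (suc j ℕ.* (A ℕ.* B)) Tₖ cross ⟩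
    + 1 / Tₖ
  ∎)
  where
  open ≡-Reasoning
  k = suc (suc j)
  A = T (suc j) (suc i)
  B = T (suc j) (suc (suc i))
  C = T j (suc (suc i))
  Tₖ = T k (suc i)
  instance
    A≢0 = T-nonZero (suc j) i
    B≢0 = T-nonZero (suc j) (suc i)
    Tₖ≢0 = T-nonZero k i
    AB≢0 = ℕP.m*n≢0 A B
    jAB≢0 = ℕP.m*n≢0 (suc j) (A ℕ.* B)
  -- B = A + C holds by definition of T, so the numerator difference is C.
  cross : + k ℤ.* (+ 1 ℤ.* + B ℤ.- + 1 ℤ.* + A) ℤ.* + Tₖ ≡ + 1 ℤ.* + (suc j ℕ.* (A ℕ.* B))
  cross = begin
      + k ℤ.* (+ 1 ℤ.* + (A ℕ.+ C) ℤ.- + 1 ℤ.* + A) ℤ.* + Tₖ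
    ≡⟨ cong (λ b → + k ℤ.* (+ 1 ℤ.* b ℤ.- + 1 ℤ.* + A) ℤ.* + Tₖ) (ℤP.pos-+ A C) ⟩
      + k ℤ.* (+ 1 ℤ.* (+ A ℤ.+ + C) ℤ.- + 1 ℤ.* + A) ℤ.* + Tₖ
    ≡⟨ ℤ-rearrange (+ k) (+ A) (+ C) (+ Tₖ) ⟩
      + k ℤ.* + Tₖ ℤ.* + C
    ≡⟨ sym (trans (ℤP.pos-* (k ℕ.* Tₖ) C) (cong (ℤ._* + C) (ℤP.pos-* k Tₖ))) ⟩
      + (k ℕ.* Tₖ ℕ.* C)
    ≡⟨ cong +_ (T-cross j i) ⟩
      + (suc j ℕ.* (A ℕ.* B))
    ≡⟨ sym (ℤP.*-identityˡ _) ⟩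
      + 1 ℤ.* + (suc j ℕ.* (A ℕ.* B))
    ∎
    where
    open import Data.Integer.Tactic.RingSolver using (solve-∀)
    ℤ-rearrange : ∀ (x a c t : ℤ) → x ℤ.* (+ 1 ℤ.* (a ℤ.+ c) ℤ.- + 1 ℤ.* a) ℤ.* t ≡ x ℤ.* t ℤ.* c
    ℤ-rearrange = solve-∀

1/T-nonNeg : ∀ k i → 0ℚ ≤ 1/T k i
1/T-nonNeg k i = *≤*⇒/≤/ 0 1 1 (T k (suc i)) {{_}} {{T-nonZero k i}} ℕ.z≤n

1/T-antitone : ∀ k i → 1/T (suc k) (suc i) ≤ 1/T (suc k) i
1/T-antitone k i = *≤*⇒/≤/ 1 1 (T (suc k) (suc (suc i))) (T (suc k) (suc i))
  {{T-nonZero (suc k) (suc i)}} {{T-nonZero (suc k) i}}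
  (ℕP.*-monoʳ-≤ 1 (ℕP.m≤m+n (T (suc k) (suc i)) (T k (suc (suc i)))))

1/T-≤ : ∀ k i → 1/T (suc k) i ≤ + 1 / suc i
1/T-≤ k i = *≤*⇒/≤/ 1 1 (T (suc k) (suc i)) (suc i) {{T-nonZero (suc k) i}}
  (ℕP.*-monoʳ-≤ 1 (n≤T k (suc i)))

ratio-nonNeg : ∀ k h → 0ℚ ≤ ratio k h
ratio-nonNeg k h = *≤*⇒/≤/ 0 k 1 (k ∸ 1) {{_}} {{ℕ.>-nonZero (ℕP.m<n⇒0<n∸m h)}} ℕ.z≤n

ratio-≤-2 : ∀ k h → ratio k h ≤ + 2 / 1
ratio-≤-2 (suc zero)    (ℕ.s≤s ())
ratio-≤-2 (suc (suc j)) h = *≤*⇒/≤/ (suc (suc j)) 2 (suc j) 1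
  (subst₂ ℕ._≤_ (sym (ℕP.*-identityʳ (suc (suc j)))) (ℕP.*-comm (suc j) 2) (ℕ.s≤s (ℕ.s≤s (ℕP.m≤m*n j 2))))

S-isCauchy : ∀ k → IsCauchy (S (suc k))
S-isCauchy k = isCauchy-if-increments-≤ (S (suc k)) 1 λ m d →
  subst (_≤ + 1 / suc m)
        (cong₂ (λ x y → ∣ x - y ∣) (sym (S≡alternatingSum (suc k) (m ℕ.+ d))) (sym (S≡alternatingSum (suc k) m)))
        (≤-trans (alternatingSum-increment-≤ (1/T (suc k)) (1/T-antitone k) (1/T-nonNeg (suc k)) m d)
                 (1/T-≤ k m))

S-recurrence : ∀ k (h : 1 ℕ.< k) N →
  S k N ≡ ratio k h * (two * S (k ∸ 1) N - 1ℚ + sign N * 1/T (k ∸ 1) N)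
S-recurrence k h N = begin
    S k N
  ≡⟨ S≡alternatingSum k N ⟩
    alternatingSum (1/T k) N
  ≡⟨ alternatingSum-cong (1/T-telescope k h) N ⟩
    alternatingSum (λ i → ratio k h * (b i - b (suc i))) N
  ≡⟨ alternatingSum-*ˡ (ratio k h) (λ i → b i - b (suc i)) N ⟩
    ratio k h * alternatingSum (λ i → b i - b (suc i)) N
  ≡⟨ cong (ratio k h *_) (alternatingSum-telescope b N) ⟩
    ratio k h * (two * alternatingSum b N - b 0 + sign N * b N)
  ≡⟨ cong₂ (λ x y → ratio k h * (two * x - y + sign N * b N)) (sym (S≡alternatingSum (k ∸ 1) N)) (1/T-0 (k ∸ 1)) ⟩
    ratio k h * (two * S (k ∸ 1) N - 1ℚ + sign N * b N)
  ∎
  where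
  open ≡-Reasoning
  b = 1/T (k ∸ 1)

S-recurrence-error : ∀ k (h : 1 ℕ.< k) m →
  ∣ S k m - ratio k h * (two * S (k ∸ 1) m - 1ℚ) ∣ ≤ + 2 / suc m
S-recurrence-error (suc zero)       (ℕ.s≤s ())
S-recurrence-error k@(suc (suc j)) h m = begin
    ∣ S k m - r * X ∣
  ≡⟨ cong (λ x → ∣ x - r * X ∣) (S-recurrence k h m) ⟩
    ∣ r * (X + sign m * b) - r * X ∣
  ≡⟨ cong ∣_∣ (solve 4 (λ r X s b → r :* (X :+ s :* b) :- r :* X := s :* (r :* b)) refl r X (sign m) b) ⟩
    ∣ sign m * (r * b) ∣
  ≡⟨ ∣sign*p∣≡∣p∣ m (r * b) ⟩
    ∣ r * b ∣
  ≡⟨ 0≤p⇒∣p∣≡p (nonNegative⁻¹ (r * b) {{nonNeg*nonNeg⇒nonNeg r b}}) ⟩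
    r * b
  ≤⟨ *-monoʳ-≤-nonNeg b (ratio-≤-2 k h) ⟩
    + 2 / 1 * b
  ≤⟨ *-monoˡ-≤-nonNeg (+ 2 / 1) (1/T-≤ j m) ⟩
    + 2 / 1 * (+ 1 / suc m)
  ≡⟨ trans (/*/ (+ 2) (+ 1) 1 (suc m)) (/-cong {p₁ = + 2} refl (ℕP.*-identityˡ (suc m))) ⟩
    + 2 / suc m
  ∎
  where
  open ≤-Reasoning
  r = ratio k h
  b = 1/T (suc j) m
  X = two * S (suc j) m - 1ℚ
  instance
    r≥0 = nonNegative (ratio-nonNeg k h)
    b≥0 = nonNegative (1/T-nonNeg (suc j) m)

theorem2p3 : (k : ℕ) → (h : 1 ℕ.< k) →
    IsCauchy (S k) × IsCauchy (S (k ∸ 1)) ×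
    SameLimit (S k) (λ N → ratio k h * (two * S (k ∸ 1) N - 1ℚ))
theorem2p3 (suc zero)    (ℕ.s≤s ())
theorem2p3 k@(suc (suc j)) h =
  S-isCauchy (suc j) , S-isCauchy j , sameLimit-if-≤ (S k) (λ N → ratio k h * (two * S (k ∸ 1) N - 1ℚ)) 2
    (S-recurrence-error k h)
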